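{- Let $n\in\mathbb{N}^*$, $V=\{v_1<\dots<v_{2n}\}$, and $\theta=\{(v_{l_h},v_{r_h})\}_{h=1}^n\in NCPP(V)$. Then for every $k\in\{1,\dots,n\}$, $$d_\theta(v_{l_k},v_{r_k})=\big|\{h:r_h>r_k\}\big|-\big|\{h:l_h>r_k\}\big|.$$ In particular, $d_\theta(v_{l_n},v_{r_n})=2n-r_n=2n-l_n-1$.
   Context: For a finite totally ordered set $V=\{v_1<\dots<v_{2n}\}$, a pair partition of $V$ is a set $\{(v_{i_h},v_{j_h})\}_{h=1}^n$ with $\{i_h,j_h:h\}=\{1,\dots,2n\}$, $i_h<j_h$ for all $h$, and $1=i_1<\dots<i_n$. It is non-crossing if for all $1\le k<h\le n$: $i_k<i_h<j_k\iff i_k<j_h<j_k$. $NCPP(V)$ denotes the set of non-crossing pair partitions of $V$. For $\theta=\{(v_{l_h},v_{r_h})\}_{h=1}^n\in NCPP(V)$ and $k\in\{1,\dots,n\}$, the depth of the pair $(v_{l_k},v_{r_k})$ in $\theta$ is $d_\theta(v_{l_k},v_{r_k}):=\big|\{h\in\{1,\dots,n\}:l_h<l_k<r_k<r_h\}\big|$. -}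

module Defs where

open import Data.Nat using (ℕ; zero; suc; _+_; _*_; _<_; _≤_; _<?_)
open import Data.Fin using (Fin; toℕ)
open import Data.List using (List; length; filter; allFin)
open import Data.Product using (_×_; ∃)
open import Data.Sum using (_⊎_)
open import Relation.Binary.PropositionalEquality using (_≡_)
open import Relation.Nullary using (Dec)
open import Relation.Nullary.Decidable using (_×-dec_)
open import Function.Bundles using (_⇔_)

-- We identify V = {v_1 < ... < v_{2n}} with its index set {1,...,2n} ⊆ ℕ
-- (everything in the statement depends only on indices).
-- A family of pairs (l_h, r_h), h = 1..n, is encoded by l r : Fin n → ℕ,
-- where the Fin index 0 corresponds to h = 1.

card : (n : ℕ) → {P : Fin n → Set} → ((h : Fin n) → Dec (P h)) → ℕ
card n P? = length (filter P? (allFin n))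

record IsPairPartition (n : ℕ) (l r : Fin n → ℕ) : Set where
  field
    l-range : ∀ h → 1 ≤ l h
    r-range : ∀ h → r h ≤ 2 * n
    l<r     : ∀ h → l h < r h
    cover   : ∀ i → 1 ≤ i → i ≤ 2 * n → ∃ λ h → (l h ≡ i ⊎ r h ≡ i)
    l-mono  : ∀ h h' → toℕ h < toℕ h' → l h < l h'

NonCrossing : (n : ℕ) → (l r : Fin n → ℕ) → Set
NonCrossing n l r = ∀ (k h : Fin n) → toℕ k < toℕ h →
  ((l k < l h × l h < r k) ⇔ (l k < r h × r h < r k))

record IsNCPP (n : ℕ) (l r : Fin (suc n) → ℕ) : Set where
  field
    pp    : IsPairPartition (suc n) l r
    first : l Fin.zero ≡ 1
    nc    : NonCrossing (suc n) l r

depth : (n : ℕ) → (l r : Fin n → ℕ) → Fin n → ℕ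
depth n l r k = card n (λ h → (l h <? l k) ×-dec ((l k <? r k) ×-dec (r k <? r h)))

{-# OPTIONS --safe #-}
-- Every value in {1,…,2n} is an endpoint.  Hence the number of endpoints above c is at
-- least 2n − c, while it drops by at least one at each step from its value 2n at c = 0;
-- so it is exactly 2n − c, and no value is an endpoint of two pairs.
-- A pair ending after r_k either encloses pair k, which is what the depth counts, or, by
-- non-crossing and distinctness of endpoints, starts after r_k.  The last pair has the
-- largest left endpoint, so no pair starts after r_n and its depth is the number 2n − r_n
-- of endpoints above r_n; finally l_n + 1 must be r_n, since the right endpoint of an
-- earlier pair there would cross the last pair.
module Submission where

open import Defs
open import Data.Nat using (ℕ; suc; _*_; _∸_; _<?_)
open import Data.Fin using (Fin; fromℕ)
open import Data.Integer using (+_; _-_)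
open import Data.Product using (_×_)
open import Relation.Binary.PropositionalEquality using (_≡_)

open import Data.Nat using (zero; _+_; _<_; _≤_; _≟_; z≤n; s≤s; z<s)
open import Data.Nat.Properties
open import Algebra.Properties.CommutativeSemigroup +-commutativeSemigroup using (interchange)
open import Data.Fin using (toℕ)
open import Data.Fin.Properties using (≤fromℕ) renaming (<-cmp to <-cmpᶠ)
open import Data.Integer using (_⊖_)
open import Data.Integer.Properties using (m-n≡m⊖n; ⊖-≥)
open import Data.List using ([]; _∷_; length; filter; allFin)
open import Data.List.Properties
  using (filter-accept; filter-reject; filter-all; filter-none; filter-some; length-tabulate)
open import Data.List.Membership.Propositional using (lose)
open import Data.List.Membership.Propositional.Properties using (∈-allFin)
import Data.List.Relation.Unary.All as All
open import Data.Product using (_,_; proj₂)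
open import Data.Sum using (_⊎_; inj₁; inj₂; [_,_]; map₁)
open import Function using (_∘_)
open import Function.Bundles using (Equivalence)
open import Relation.Nullary.Decidable using (_×-dec_)
open import Relation.Binary.Definitions using (tri<; tri≈; tri>)
open import Relation.Binary.PropositionalEquality
  using (_≢_; refl; sym; trans; cong; cong₂; subst; module ≡-Reasoning)
open import Relation.Nullary using (Dec; yes; no; ¬_; contradiction)

module _ {a p q r} {A : Set a} {P : A → Set p} {Q : A → Set q} {R : A → Set r}
         (P? : ∀ x → Dec (P x)) (Q? : ∀ x → Dec (Q x)) (R? : ∀ x → Dec (R x))
         (P⇒Q⊎R : ∀ {x} → P x → Q x ⊎ R x) (Q⇒P : ∀ {x} → Q x → P x) (R⇒P : ∀ {x} → R x → P x)
         (Q⇒¬R : ∀ {x} → Q x → ¬ R x) where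

  length-filter-⊎ : ∀ xs → length (filter P? xs) ≡ length (filter Q? xs) + length (filter R? xs)
  length-filter-⊎ [] = refl
  length-filter-⊎ (x ∷ xs) with Q? x | R? x
  ... | yes qx | yes rx = contradiction rx (Q⇒¬R qx)
  ... | yes qx | no _   rewrite filter-accept P? {xs = xs} (Q⇒P qx) =
    cong suc (length-filter-⊎ xs)
  ... | no _   | yes rx rewrite filter-accept P? {xs = xs} (R⇒P rx) =
    trans (cong suc (length-filter-⊎ xs)) (sym (+-suc _ _))
  ... | no ¬qx | no ¬rx rewrite filter-reject P? {xs = xs} ([ ¬qx , ¬rx ] ∘ P⇒Q⊎R) =
    length-filter-⊎ xs

module _ {n : ℕ} {P : Fin n → Set} (P? : ∀ h → Dec (P h)) where

  card-pos : ∀ h → P h → 0 < card n P?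
  card-pos h p = filter-some P? (lose (∈-allFin h) p)

  card-all : (∀ h → P h) → card n P? ≡ n
  card-all p = trans (cong length (filter-all P? {xs = allFin n} (All.tabulate (λ {h} _ → p h))))
                     (length-tabulate (λ h → h))

  card-none : (∀ h → ¬ P h) → card n P? ≡ 0
  card-none ¬p = cong length (filter-none P? {xs = allFin n} (All.tabulate (λ {h} _ → ¬p h)))

card-above-suc : ∀ {n} (f : Fin n → ℕ) c →
  card n (λ h → c <? f h) ≡ card n (λ h → suc c <? f h) + card n (λ h → suc c ≟ f h)
card-above-suc {n} f c =
  length-filter-⊎ _ _ _ m≤n⇒m<n∨m≡n <⇒≤ ≤-reflexive <⇒≢ (allFin n)

m≡n+o⇒+n≡+m-+o : ∀ {m n o} → m ≡ n + o → + n ≡ + m - + o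
m≡n+o⇒+n≡+m-+o {n = n} {o} refl = begin
  + n              ≡⟨ cong +_ (m+n∸n≡m n o) ⟨
  + (n + o ∸ o)    ≡⟨ ⊖-≥ (m≤n+m o n) ⟨
  (n + o) ⊖ o      ≡⟨ m-n≡m⊖n (n + o) o ⟨
  + (n + o) - + o  ∎
  where open ≡-Reasoning

module Endpoints {n : ℕ} (l r : Fin n → ℕ) where

  endpointsAbove : ℕ → ℕ
  endpointsAbove c = card n (λ h → c <? l h) + card n (λ h → c <? r h)

  endpointsAt : ℕ → ℕ
  endpointsAt v = card n (λ h → v ≟ l h) + card n (λ h → v ≟ r h)

  endpointsAbove-suc : ∀ c → endpointsAbove c ≡ endpointsAbove (suc c) + endpointsAt (suc c)
  endpointsAbove-suc c = trans (cong₂ _+_ (card-above-suc l c) (card-above-suc r c))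
    (interchange (card n (λ h → suc c <? l h)) (card n (λ h → suc c ≟ l h))
                 (card n (λ h → suc c <? r h)) (card n (λ h → suc c ≟ r h)))

  module _ (pp : IsPairPartition n l r) where
    open IsPairPartition pp

    endpointsAt-pos : ∀ {v} → 0 < v → v ≤ 2 * n → 0 < endpointsAt v
    endpointsAt-pos 0<v v≤2n with cover _ 0<v v≤2n
    ... | h , inj₁ lh≡v = ≤-trans (card-pos _ h (sym lh≡v)) (m≤m+n _ _)
    ... | h , inj₂ rh≡v = ≤-trans (card-pos _ h (sym rh≡v)) (m≤n+m _ _)

    endpointsAbove-zero : endpointsAbove 0 ≡ 2 * n
    endpointsAbove-zero = begin
      endpointsAbove 0  ≡⟨ cong₂ _+_ (card-all _ l-range) (card-all _ 0<r) ⟩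
      n + n             ≡⟨ cong (_+_ n) (+-identityʳ n) ⟨
      2 * n             ∎
      where
      open ≡-Reasoning
      0<r : ∀ h → 0 < r h
      0<r h = <-trans (l-range h) (l<r h)

    endpointsAbove+c≤2n : ∀ c → c ≤ 2 * n → endpointsAbove c + c ≤ 2 * n
    endpointsAbove+c≤2n zero    _      = ≤-reflexive (trans (+-identityʳ _) endpointsAbove-zero)
    endpointsAbove+c≤2n (suc c) 1+c≤2n = begin
      endpointsAbove (suc c) + suc c                    ≡⟨ +-suc _ c ⟩
      suc (endpointsAbove (suc c)) + c                  ≤⟨ +-monoˡ-≤ c (m<m+n _ at>0) ⟩
      endpointsAbove (suc c) + endpointsAt (suc c) + c  ≡⟨ cong (_+ c) (endpointsAbove-suc c) ⟨
      endpointsAbove c + c                              ≤⟨ endpointsAbove+c≤2n c (<⇒≤ 1+c≤2n) ⟩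
      2 * n                                             ∎
      where
      open ≤-Reasoning
      at>0 : 0 < endpointsAt (suc c)
      at>0 = endpointsAt-pos z<s 1+c≤2n

    ≤endpointsAbove : ∀ j c → c + j ≡ 2 * n → j ≤ endpointsAbove c
    ≤endpointsAbove zero    c _        = z≤n
    ≤endpointsAbove (suc j) c c+1+j≡2n = begin
      suc j                                         ≤⟨ s≤s (≤endpointsAbove j (suc c) 1+c+j≡2n) ⟩
      suc (endpointsAbove (suc c))                  ≤⟨ m<m+n _ (endpointsAt-pos z<s 1+c≤2n) ⟩
      endpointsAbove (suc c) + endpointsAt (suc c)  ≡⟨ endpointsAbove-suc c ⟨
      endpointsAbove c                              ∎
      where
      open ≤-Reasoning
      1+c+j≡2n : suc c + j ≡ 2 * n
      1+c+j≡2n = trans (sym (+-suc c j)) c+1+j≡2n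
      1+c≤2n : suc c ≤ 2 * n
      1+c≤2n = ≤-trans (m≤m+n (suc c) j) (≤-reflexive 1+c+j≡2n)

    endpointsAbove+c≡2n : ∀ c → c ≤ 2 * n → endpointsAbove c + c ≡ 2 * n
    endpointsAbove+c≡2n c c≤2n = ≤-antisym (endpointsAbove+c≤2n c c≤2n) (begin
      2 * n                 ≡⟨ m∸n+n≡m c≤2n ⟨
      (2 * n ∸ c) + c       ≤⟨ +-monoˡ-≤ c (≤endpointsAbove (2 * n ∸ c) c (m+[n∸m]≡n c≤2n)) ⟩
      endpointsAbove c + c  ∎)
      where open ≤-Reasoning

    endpointsAt≡1 : ∀ {v} → 0 < v → v ≤ 2 * n → endpointsAt v ≡ 1
    endpointsAt≡1 {suc c} _ 1+c≤2n = +-cancelˡ-≡ a _ _ (+-cancelʳ-≡ c _ _ (begin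
      a + endpointsAt (suc c) + c  ≡⟨ cong (_+ c) (endpointsAbove-suc c) ⟨
      endpointsAbove c + c         ≡⟨ endpointsAbove+c≡2n c (<⇒≤ 1+c≤2n) ⟩
      2 * n                        ≡⟨ endpointsAbove+c≡2n (suc c) 1+c≤2n ⟨
      a + suc c                    ≡⟨ +-assoc a 1 c ⟨
      a + 1 + c                    ∎))
      where
      open ≡-Reasoning
      a : ℕ
      a = endpointsAbove (suc c)

    l≢r : ∀ h k → l h ≢ r k
    l≢r h k lh≡rk = n≮n 1 (begin-strict
      1                  <⟨ +-mono-≤ (card-pos _ h refl) (card-pos _ k lh≡rk) ⟩
      endpointsAt (l h)  ≡⟨ endpointsAt≡1 (l-range h) lh≤2n ⟩
      1                  ∎)
      where
      open ≤-Reasoning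
      lh≤2n : l h ≤ 2 * n
      lh≤2n = ≤-trans (<⇒≤ (l<r h)) (r-range h)

module NonCrossingPairs {m : ℕ} {l r : Fin (suc m) → ℕ} (ncpp : IsNCPP m l r) where
  open IsNCPP ncpp
  open IsPairPartition pp
  open Endpoints l r

  n : ℕ
  n = suc m

  last : Fin n
  last = fromℕ m

  l-injective : ∀ {h k} → l h ≡ l k → h ≡ k
  l-injective {h} {k} lh≡lk with <-cmpᶠ h k
  ... | tri< h<k _ _ = contradiction lh≡lk (<⇒≢ (l-mono h k h<k))
  ... | tri≈ _ h≡k _ = h≡k
  ... | tri> _ _ k<h = contradiction lh≡lk (>⇒≢ (l-mono k h k<h))

  l-cancel-< : ∀ {k h} → l k < l h → toℕ k < toℕ h
  l-cancel-< {k} {h} lk<lh with <-cmpᶠ k h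
  ... | tri< k<h _ _  = k<h
  ... | tri≈ _ refl _ = contradiction lk<lh (n≮n (l k))
  ... | tri> _ _ h<k  = contradiction lk<lh (<-asym (l-mono h k h<k))

  encloses-or-follows : ∀ {k h} → r k < r h → l h < l k ⊎ r k < l h
  encloses-or-follows {k} {h} rk<rh with <-cmp (l h) (l k)
  ... | tri< lh<lk _ _ = inj₁ lh<lk
  ... | tri≈ _ lh≡lk _ = contradiction rk<rh (<-irrefl (cong r (l-injective (sym lh≡lk))))
  ... | tri> _ _ lk<lh with <-cmp (l h) (r k)
  ...   | tri< lh<rk _ _ = contradiction rh<rk (<-asym rk<rh)
    where
    rh<rk : r h < r k
    rh<rk = proj₂ (Equivalence.to (nc k h (l-cancel-< lk<lh)) (lk<lh , lh<rk))
  ...   | tri≈ _ lh≡rk _ = contradiction lh≡rk (l≢r pp h k)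
  ...   | tri> _ _ rk<lh = inj₂ rk<lh

  card-r>r≡depth+card-l>r : ∀ k →
    card n (λ h → r k <? r h) ≡ depth n l r k + card n (λ h → r k <? l h)
  card-r>r≡depth+card-l>r k = length-filter-⊎
    (λ h → r k <? r h)
    (λ h → (l h <? l k) ×-dec ((l k <? r k) ×-dec (r k <? r h)))
    (λ h → r k <? l h)
    (λ rk<rh → map₁ (λ lh<lk → lh<lk , l<r k , rk<rh) (encloses-or-follows rk<rh))
    (proj₂ ∘ proj₂)
    (λ {h} rk<lh → <-trans rk<lh (l<r h))
    (λ (lh<lk , lk<rk , _) → <-asym (<-trans lh<lk lk<rk))
    (allFin n)

  l≤l-last : ∀ h → l h ≤ l last
  l≤l-last h with <-cmpᶠ h last
  ... | tri< h<last _ _ = <⇒≤ (l-mono h last h<last)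
  ... | tri≈ _ refl _   = ≤-refl
  ... | tri> _ _ last<h = contradiction (≤fromℕ h) (<⇒≱ last<h)

  card-l>r-last≡0 : card n (λ h → r last <? l h) ≡ 0
  card-l>r-last≡0 = card-none (λ h → r last <? l h)
    (λ h rlast<lh → <-asym rlast<lh (≤-<-trans (l≤l-last h) (l<r last)))

  depth-last : depth n l r last ≡ 2 * n ∸ r last
  depth-last = begin
    d                                          ≡⟨ +-identityʳ d ⟨
    d + 0                                      ≡⟨ cong (_+_ d) card-l>r-last≡0 ⟨
    d + startsAfter                            ≡⟨ card-r>r≡depth+card-l>r last ⟨
    endsAfter                                  ≡⟨ cong (_+ endsAfter) card-l>r-last≡0 ⟨
    endpointsAbove (r last)                    ≡⟨ m+n∸n≡m _ (r last) ⟨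
    endpointsAbove (r last) + r last ∸ r last  ≡⟨ cong (_∸ r last) above+rlast≡2n ⟩
    2 * n ∸ r last                             ∎
    where
    open ≡-Reasoning
    d startsAfter endsAfter : ℕ
    d = depth n l r last
    startsAfter = card n (λ h → r last <? l h)
    endsAfter = card n (λ h → r last <? r h)
    above+rlast≡2n : endpointsAbove (r last) + r last ≡ 2 * n
    above+rlast≡2n = endpointsAbove+c≡2n pp (r last) (r-range last)

  r-last≡1+l-last : r last ≡ suc (l last)
  r-last≡1+l-last with cover (suc (l last)) z<s (≤-trans (l<r last) (r-range last))
  ... | h , inj₁ lh≡1+llast =
    contradiction (subst (_≤ l last) lh≡1+llast (l≤l-last h)) (n≮n (l last))
  ... | h , inj₂ rh≡1+llast with <-cmpᶠ h last
  ...   | tri≈ _ refl _   = rh≡1+llast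
  ...   | tri> _ _ last<h = contradiction (≤fromℕ h) (<⇒≱ last<h)
  ...   | tri< h<last _ _ = contradiction rlast≤llast (<⇒≱ (l<r last))
    where
    rlast<rh : r last < r h
    rlast<rh = proj₂ (Equivalence.to (nc h last h<last)
                                     (l-mono h last h<last , ≤-reflexive (sym rh≡1+llast)))
    rlast≤llast : r last ≤ l last
    rlast≤llast = m<1+n⇒m≤n (subst (r last <_) rh≡1+llast rlast<rh)

proposition2p12 : (m : ℕ) (l r : Fin (suc m) → ℕ) → IsNCPP m l r →
    ((k : Fin (suc m)) →
      + depth (suc m) l r k ≡ + card (suc m) (λ h → r k <? r h) - + card (suc m) (λ h → r k <? l h))
    × (depth (suc m) l r (fromℕ m) ≡ 2 * suc m ∸ r (fromℕ m)
       × 2 * suc m ∸ r (fromℕ m) ≡ 2 * suc m ∸ l (fromℕ m) ∸ 1)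
proposition2p12 m l r ncpp =
    (λ k → m≡n+o⇒+n≡+m-+o (card-r>r≡depth+card-l>r k))
  , depth-last
  , (begin
      2 * n ∸ r last          ≡⟨ cong (2 * n ∸_) r-last≡1+l-last ⟩
      2 * n ∸ suc (l last)    ≡⟨ cong (2 * n ∸_) (+-comm 1 (l last)) ⟩
      2 * n ∸ (l last + 1)    ≡⟨ ∸-+-assoc (2 * n) (l last) 1 ⟨
      2 * n ∸ l last ∸ 1      ∎)
  where
  open NonCrossingPairs ncpp
  open ≡-Reasoning
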